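{- Let $X$ and $Y$ be words. Then $X\sim Y$ if and only if there is a sequence of swaps between $X$ and $Y$, i.e. there exist words $Z_1=X,Z_2,\dots,Z_k=Y$ such that for each $1\le i\le k-1$ there are nonempty balanced words $F,G$ and words $W_1,W_2$ with $\{Z_i,Z_{i+1}\}=\{W_1FGW_2,\,W_1GFW_2\}$.
   Context: Let $\mathcal{A}$ be the free associative $\mathbb{C}$-algebra on two generators $L$ and $R$ (letters). A word is a finite product of letters (possibly empty); words form a $\mathbb{C}$-basis of $\mathcal{A}$. A word is balanced if $L$ and $R$ occur in it equally many times. Let $S=\{FG-GF\colon F,G \text{ nonempty balanced words}\}$, let $\mathcal{J}$ be the two-sided ideal of $\mathcal{A}$ generated by $S$, and for words $X,Y$ write $X\sim Y$ if $X-Y\in\mathcal{J}$. -}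

module Defs where

open import Level using (_⊔_)
open import Algebra.Bundles using (CommutativeRing)
open import Data.Nat using (ℕ; zero; suc)
open import Data.List using (List; []; _∷_; _++_; concatMap; map)
open import Data.Product using (_×_; _,_; ∃; Σ)
open import Data.Sum using (_⊎_)
open import Relation.Nullary using (¬_; yes; no)
open import Relation.Binary.PropositionalEquality using (_≡_; refl)
open import Relation.Binary.Construct.Closure.ReflexiveTransitive using (Star)

data Letter : Set where
  L R : Letter

Word : Set
Word = List Letter

_≟L_ : (a b : Letter) → Relation.Nullary.Dec (a ≡ b)
L ≟L L = yes refl
L ≟L R = no (λ ())
R ≟L L = no (λ ())
R ≟L R = yes refl

_≟W_ : (u v : Word) → Relation.Nullary.Dec (u ≡ v)
[] ≟W [] = yes refl
[] ≟W (_ ∷ _) = no (λ ())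
(_ ∷ _) ≟W [] = no (λ ())
(a ∷ u) ≟W (b ∷ v) with a ≟L b | u ≟W v
... | yes refl | yes refl = yes refl
... | no a≢b | _ = no (λ { refl → a≢b refl })
... | yes _ | no u≢v = no (λ { refl → u≢v refl })

countL : Word → ℕ
countL [] = zero
countL (L ∷ w) = suc (countL w)
countL (R ∷ w) = countL w

countR : Word → ℕ
countR [] = zero
countR (L ∷ w) = countR w
countR (R ∷ w) = suc (countR w)

Balanced : Word → Set
Balanced w = countL w ≡ countR w

NonemptyBalanced : Word → Set
NonemptyBalanced w = (¬ w ≡ []) × Balanced w

Swap : Word → Word → Set
Swap Z Z′ = ∃ λ W₁ → ∃ λ F → ∃ λ G → ∃ λ W₂ →
  NonemptyBalanced F × NonemptyBalanced G ×
  ((Z ≡ W₁ ++ (F ++ G) ++ W₂ × Z′ ≡ W₁ ++ (G ++ F) ++ W₂)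
   ⊎ (Z ≡ W₁ ++ (G ++ F) ++ W₂ × Z′ ≡ W₁ ++ (F ++ G) ++ W₂))

SwapSeq : Word → Word → Set
SwapSeq = Star Swap

record Field c ℓ : Set (Level.suc (c ⊔ ℓ)) where
  field
    commutativeRing : CommutativeRing c ℓ
  open CommutativeRing commutativeRing public
  field
    1≉0     : ¬ (1# ≈ 0#)
    inverse : ∀ x → ¬ (x ≈ 0#) → ∃ λ y → x * y ≈ 1#

-- The free associative K-algebra on {L, R}: elements are formal finite
-- K-linear combinations of words, compared by their coefficients.

module FreeAlgebra {c ℓ} (K : Field c ℓ) where
  open Field K

  Poly : Set c
  Poly = List (Carrier × Word)

  coeff : Poly → Word → Carrier
  coeff [] w = 0#
  coeff ((a , u) ∷ p) w with u ≟W w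
  ... | yes _ = a + coeff p w
  ... | no _  = coeff p w

  _≋_ : Poly → Poly → Set ℓ
  p ≋ q = ∀ w → coeff p w ≈ coeff q w

  _⊕_ : Poly → Poly → Poly
  p ⊕ q = p ++ q

  _⊗_ : Poly → Poly → Poly
  p ⊗ q = concatMap (λ { (a , u) → map (λ { (b , v) → (a * b , u ++ v) }) q }) p

  word : Word → Poly
  word w = (1# , w) ∷ []

  _⊖_ : Poly → Poly → Poly
  p ⊖ q = p ++ map (λ { (b , v) → (- b , v) }) q

  data InS : Poly → Set where
    comm : ∀ F G → NonemptyBalanced F → NonemptyBalanced G →
           InS (word (F ++ G) ⊖ word (G ++ F))

  data InJ : Poly → Set (c ⊔ ℓ) where
    gen  : ∀ {p} → InS p → InJ p
    zer  : InJ []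
    add  : ∀ {p q} → InJ p → InJ q → InJ (p ⊕ q)
    lmul : ∀ {p} (a : Poly) → InJ p → InJ (a ⊗ p)
    rmul : ∀ {p} (b : Poly) → InJ p → InJ (p ⊗ b)
    resp : ∀ {p q} → p ≋ q → InJ p → InJ q

  _∼_ : Word → Word → Set (c ⊔ ℓ)
  X ∼ Y = InJ (word X ⊖ word Y)

-- If X − Y lies in the ideal J then, following how J is generated, X − Y is
-- coefficientwise equal to a sum of "edges" a·U + b·V with a + b = 0 and U, V
-- joined by a swap sequence: generators are single edges, and multiplying by a
-- word on either side maps edges to edges because swaps are stable under
-- prefixing and suffixing.  Renaming V to U everywhere makes the first edge
-- cancel while keeping every word joined to its image, so induction on the
-- number of edges joins X to Y.  Conversely a swap W₁FGW₂ ↦ W₁GFW₂ is the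
-- element W₁(FG − GF)W₂ of J.  The only non-formal step is that every linear
-- functional respects coefficientwise equality, proved by grouping like terms.

module Submission where

open import Defs
open import Function.Base using (id)
open import Function.Bundles using (_⇔_; mk⇔)
open import Level using (_⊔_)
open import Data.Nat using (suc; _≤_; s≤s)
open import Data.Nat.Properties using (≤-trans; ≤-refl)
open import Data.List using (List; []; _∷_; _++_; map; length; filter)
open import Data.List.Properties using (++-assoc; ++-identityʳ; length-map; length-filter; filter-reject)
open import Data.Product as Prod using (_×_; _,_; proj₂)
open import Data.Sum as Sum using (inj₁; inj₂)
open import Data.Empty using (⊥-elim)
open import Relation.Nullary using (¬_; Dec; yes; no; ¬?)
open import Relation.Binary using (Setoid; IsEquivalence; _Preserves_⟶_)
open import Relation.Binary.PropositionalEquality as ≡ using (_≡_; refl; cong₂)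
open import Relation.Binary.Construct.Closure.ReflexiveTransitive
  using (ε; _◅_; _◅◅_; gmap; reverse; fold)
import Algebra.Properties.CommutativeSemigroup as CommutativeSemigroupProperties
import Algebra.Properties.Group as GroupProperties
import Algebra.Properties.Ring as RingProperties
import Relation.Binary.Reasoning.Setoid as SetoidReasoning

Swap-sym : ∀ {Z Z′} → Swap Z Z′ → Swap Z′ Z
Swap-sym (W₁ , F , G , W₂ , nF , nG , eqs) =
  W₁ , F , G , W₂ , nF , nG , Sum.swap (Sum.map Prod.swap Prod.swap eqs)

SwapSeq-sym : ∀ {Z Z′} → SwapSeq Z Z′ → SwapSeq Z′ Z
SwapSeq-sym = reverse Swap-sym

Swap-++ˡ : ∀ u {Z Z′} → Swap Z Z′ → Swap (u ++ Z) (u ++ Z′)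
Swap-++ˡ u (W₁ , F , G , W₂ , nF , nG , eqs) =
  u ++ W₁ , F , G , W₂ , nF , nG , Sum.map (Prod.map reassoc reassoc) (Prod.map reassoc reassoc) eqs
  where
  reassoc : ∀ {Z M} → Z ≡ W₁ ++ M → u ++ Z ≡ (u ++ W₁) ++ M
  reassoc refl = ≡.sym (++-assoc u W₁ _)

Swap-++ʳ : ∀ v {Z Z′} → Swap Z Z′ → Swap (Z ++ v) (Z′ ++ v)
Swap-++ʳ v (W₁ , F , G , W₂ , nF , nG , eqs) =
  W₁ , F , G , W₂ ++ v , nF , nG , Sum.map (Prod.map reassoc reassoc) (Prod.map reassoc reassoc) eqs
  where
  reassoc : ∀ {Z A} → Z ≡ W₁ ++ A ++ W₂ → Z ++ v ≡ W₁ ++ A ++ W₂ ++ v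
  reassoc {A = A} refl = ≡.trans (++-assoc W₁ (A ++ W₂) v) (≡.cong (W₁ ++_) (++-assoc A W₂ v))

SwapSeq-++ˡ : ∀ u → (u ++_) Preserves SwapSeq ⟶ SwapSeq
SwapSeq-++ˡ u = gmap (u ++_) (Swap-++ˡ u)

SwapSeq-++ʳ : ∀ v → (_++ v) Preserves SwapSeq ⟶ SwapSeq
SwapSeq-++ʳ v = gmap (_++ v) (Swap-++ʳ v)

Swap-++-comm : ∀ {F G} → NonemptyBalanced F → NonemptyBalanced G → Swap (F ++ G) (G ++ F)
Swap-++-comm {F} {G} nF nG =
  [] , F , G , [] , nF , nG , inj₁ (≡.sym (++-identityʳ _) , ≡.sym (++-identityʳ _))

merge : Word → Word → Word → Word
merge U V w with w ≟W V
... | yes _ = U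
... | no  _ = w

merge-source : ∀ U V → merge U V U ≡ U
merge-source U V with U ≟W V
... | yes _ = refl
... | no  _ = refl

merge-target : ∀ U V → merge U V V ≡ U
merge-target U V with V ≟W V
... | yes _   = refl
... | no V≢V = ⊥-elim (V≢V refl)

merge-linked : ∀ {U V} → SwapSeq U V → ∀ w → SwapSeq w (merge U V w)
merge-linked {V = V} U⇝V w with w ≟W V
... | yes refl = SwapSeq-sym U⇝V
... | no  _    = ε

merge-preserves : ∀ {U V} → SwapSeq U V → merge U V Preserves SwapSeq ⟶ SwapSeq
merge-preserves U⇝V {x} {y} x⇝y =
  SwapSeq-sym (merge-linked U⇝V x) ◅◅ x⇝y ◅◅ merge-linked U⇝V y

module _ {c ℓ} (K : Field c ℓ) where
  open Field K renaming (refl to ≈-refl; sym to ≈-sym; trans to ≈-trans)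
  open FreeAlgebra K
  open CommutativeSemigroupProperties +-commutativeSemigroup using (x∙yz≈y∙xz)
  open GroupProperties +-group using (ε⁻¹≈ε; x∙y⁻¹≈ε⇒x≈y)
  open RingProperties ring using (-‿+-comm; -‿distribˡ-*)

  module ≈-Reasoning = SetoidReasoning setoid

  ≋-isEquivalence : IsEquivalence _≋_
  ≋-isEquivalence = record
    { refl  = λ _ → ≈-refl
    ; sym   = λ p≋q w → ≈-sym (p≋q w)
    ; trans = λ p≋q q≋r w → ≈-trans (p≋q w) (q≋r w)
    }

  ≋-setoid : Setoid c ℓ
  ≋-setoid = record { isEquivalence = ≋-isEquivalence }

  module ≋-Reasoning = SetoidReasoning ≋-setoid

  δ : Word → Word → Carrier
  δ w u = coeff (word u) w

  coeff-∷ : ∀ a u p w → coeff ((a , u) ∷ p) w ≈ a * δ w u + coeff p w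
  coeff-∷ a u p w with u ≟W w
  ... | yes _ = +-congʳ (≈-sym (≈-trans (*-congˡ (+-identityʳ 1#)) (*-identityʳ a)))
  ... | no  _ = ≈-sym (≈-trans (+-congʳ (zeroʳ a)) (+-identityˡ _))

  coeff-++ : ∀ p q w → coeff (p ++ q) w ≈ coeff p w + coeff q w
  coeff-++ []            q w = ≈-sym (+-identityˡ _)
  coeff-++ ((a , u) ∷ p) q w with u ≟W w
  ... | yes _ = ≈-trans (+-congˡ (coeff-++ p q w)) (≈-sym (+-assoc _ _ _))
  ... | no  _ = coeff-++ p q w

  ∷-cong : ∀ {a b} u p q → a ≈ b → p ≋ q → ((a , u) ∷ p) ≋ ((b , u) ∷ q)
  ∷-cong {a} {b} u p q a≈b p≋q w = begin
    coeff ((a , u) ∷ p) w     ≈⟨ coeff-∷ a u p w ⟩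
    a * δ w u + coeff p w     ≈⟨ +-cong (*-congʳ a≈b) (p≋q w) ⟩
    b * δ w u + coeff q w     ≈⟨ coeff-∷ b u q w ⟨
    coeff ((b , u) ∷ q) w     ∎
    where open ≈-Reasoning

  ++-cong : ∀ p p′ q q′ → p ≋ p′ → q ≋ q′ → (p ++ q) ≋ (p′ ++ q′)
  ++-cong p p′ q q′ p≋p′ q≋q′ w = begin
    coeff (p ++ q) w         ≈⟨ coeff-++ p q w ⟩
    coeff p w + coeff q w    ≈⟨ +-cong (p≋p′ w) (q≋q′ w) ⟩
    coeff p′ w + coeff q′ w  ≈⟨ coeff-++ p′ q′ w ⟨
    coeff (p′ ++ q′) w       ∎
    where open ≈-Reasoning

  ++-leftComm : ∀ p q r → (p ++ (q ++ r)) ≋ (q ++ (p ++ r))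
  ++-leftComm p q r w = begin
    coeff (p ++ (q ++ r)) w              ≈⟨ ≈-trans (coeff-++ p _ w) (+-congˡ (coeff-++ q r w)) ⟩
    coeff p w + (coeff q w + coeff r w)  ≈⟨ x∙yz≈y∙xz _ _ _ ⟩
    coeff q w + (coeff p w + coeff r w)  ≈⟨ ≈-trans (coeff-++ q _ w) (+-congˡ (coeff-++ p r w)) ⟨
    coeff (q ++ (p ++ r)) w              ∎
    where open ≈-Reasoning

  cancel : ∀ {a b} u p → a + b ≈ 0# → ((a , u) ∷ (b , u) ∷ p) ≋ p
  cancel {a} {b} u p a+b≈0 w = begin
    coeff ((a , u) ∷ (b , u) ∷ p) w
      ≈⟨ ≈-trans (coeff-∷ a u _ w) (+-congˡ (coeff-∷ b u p w)) ⟩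
    a * δ w u + (b * δ w u + coeff p w)  ≈⟨ +-assoc _ _ _ ⟨
    (a * δ w u + b * δ w u) + coeff p w  ≈⟨ +-congʳ (distribʳ (δ w u) a b) ⟨
    (a + b) * δ w u + coeff p w          ≈⟨ +-congʳ (*-congʳ a+b≈0) ⟩
    0# * δ w u + coeff p w               ≈⟨ ≈-trans (+-congʳ (zeroˡ (δ w u))) (+-identityˡ _) ⟩
    coeff p w                            ∎
    where open ≈-Reasoning

  eval : (Word → Carrier) → Poly → Carrier
  eval g []            = 0#
  eval g ((a , u) ∷ p) = a * g u + eval g p

  eval-++ : ∀ g p q → eval g (p ++ q) ≈ eval g p + eval g q
  eval-++ g []            q = ≈-sym (+-identityˡ _)
  eval-++ g ((a , u) ∷ p) q = ≈-trans (+-congˡ (eval-++ g p q)) (≈-sym (+-assoc _ _ _))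

  eval-⊖ : ∀ g p q → eval g (p ⊖ q) ≈ eval g p - eval g q
  eval-⊖ g p q = ≈-trans (eval-++ g p _) (+-congˡ (eval-neg q))
    where
    eval-neg : ∀ q → eval g ([] ⊖ q) ≈ - eval g q
    eval-neg []            = ≈-sym ε⁻¹≈ε
    eval-neg ((b , v) ∷ q) =
      ≈-trans (+-cong (≈-sym (-‿distribˡ-* b (g v))) (eval-neg q)) (-‿+-comm _ _)

  coeff-as-eval : ∀ p w → coeff p w ≈ eval (δ w) p
  coeff-as-eval []            w = ≈-refl
  coeff-as-eval ((a , u) ∷ p) w = ≈-trans (coeff-∷ a u p w) (+-congˡ (coeff-as-eval p w))

  ≋⇒⊖≋[] : ∀ p q → p ≋ q → (p ⊖ q) ≋ []
  ≋⇒⊖≋[] p q p≋q w = begin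
    coeff (p ⊖ q) w              ≈⟨ coeff-as-eval (p ⊖ q) w ⟩
    eval (δ w) (p ⊖ q)           ≈⟨ eval-⊖ (δ w) p q ⟩
    eval (δ w) p - eval (δ w) q  ≈⟨ +-cong (coeff-as-eval p w) (-‿cong (coeff-as-eval q w)) ⟨
    coeff p w - coeff q w        ≈⟨ +-congʳ (p≋q w) ⟩
    coeff q w - coeff q w        ≈⟨ -‿inverseʳ _ ⟩
    0#                           ∎
    where open ≈-Reasoning

  otherWord? : ∀ u (t : Carrier × Word) → Dec (¬ proj₂ t ≡ u)
  otherWord? u t = ¬? (proj₂ t ≟W u)

  dropWord : Word → Poly → Poly
  dropWord u = filter (otherWord? u)

  eval-dropWord : ∀ g u p → eval g p ≈ coeff p u * g u + eval g (dropWord u p)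
  eval-dropWord g u [] = ≈-sym (≈-trans (+-identityʳ _) (zeroˡ (g u)))
  eval-dropWord g u ((a , v) ∷ p) with v ≟W u
  ... | yes refl = begin
    a * g v + eval g p                                     ≈⟨ +-congˡ (eval-dropWord g v p) ⟩
    a * g v + (coeff p v * g v + eval g (dropWord v p))    ≈⟨ +-assoc _ _ _ ⟨
    (a * g v + coeff p v * g v) + eval g (dropWord v p)    ≈⟨ +-congʳ (distribʳ (g v) a _) ⟨
    (a + coeff p v) * g v + eval g (dropWord v p)          ∎
    where open ≈-Reasoning
  ... | no _ = ≈-trans (+-congˡ (eval-dropWord g u p)) (x∙yz≈y∙xz _ _ _)

  dropWord-≋[] : ∀ u p → p ≋ [] → dropWord u p ≋ []
  dropWord-≋[] u p p≋[] w = begin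
    coeff (dropWord u p) w                         ≈⟨ coeff-as-eval (dropWord u p) w ⟩
    eval (δ w) (dropWord u p)
      ≈⟨ ≈-trans (+-congʳ (zeroˡ (δ w u))) (+-identityˡ _) ⟨
    0# * δ w u + eval (δ w) (dropWord u p)         ≈⟨ +-congʳ (*-congʳ (p≋[] u)) ⟨
    coeff p u * δ w u + eval (δ w) (dropWord u p)  ≈⟨ eval-dropWord (δ w) u p ⟨
    eval (δ w) p                                   ≈⟨ coeff-as-eval p w ⟨
    coeff p w                                      ≈⟨ p≋[] w ⟩
    0#                                             ∎
    where open ≈-Reasoning

  eval-≋[] : ∀ g r → r ≋ [] → eval g r ≈ 0#
  eval-≋[] g r = go (length r) r ≤-refl
    where
    go : ∀ n r → length r ≤ n → r ≋ [] → eval g r ≈ 0#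
    go _       []                  _             _    = ≈-refl
    go (suc n) r@((a , u) ∷ r′) (s≤s |r′|≤n) r≋[] = begin
      eval g r                                   ≈⟨ eval-dropWord g u r ⟩
      coeff r u * g u + eval g (dropWord u r)
        ≈⟨ +-cong (*-congʳ (r≋[] u)) (go n (dropWord u r) shorter (dropWord-≋[] u r r≋[])) ⟩
      0# * g u + 0#                              ≈⟨ ≈-trans (+-identityʳ _) (zeroˡ (g u)) ⟩
      0#                                         ∎
      where
      open ≈-Reasoning
      shorter : length (dropWord u r) ≤ n
      shorter rewrite filter-reject (otherWord? u) {x = a , u} {xs = r′} (λ u≢u → u≢u refl) =
        ≤-trans (length-filter (otherWord? u) r′) |r′|≤n

  eval-cong : ∀ g p q → p ≋ q → eval g p ≈ eval g q
  eval-cong g p q p≋q = x∙y⁻¹≈ε⇒x≈y _ _ (begin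
    eval g p - eval g q  ≈⟨ eval-⊖ g p q ⟨
    eval g (p ⊖ q)       ≈⟨ eval-≋[] g (p ⊖ q) (≋⇒⊖≋[] p q p≋q) ⟩
    0#                   ∎)
    where open ≈-Reasoning

  Homogeneous : (Carrier → Carrier) → Set (c ⊔ ℓ)
  Homogeneous σ = ∀ a → σ a ≈ a * σ 1#

  id-homogeneous : Homogeneous id
  id-homogeneous a = ≈-sym (*-identityʳ a)

  *-homogeneousˡ : ∀ k → Homogeneous (k *_)
  *-homogeneousˡ k a = ≈-trans (*-comm k a) (*-congˡ (≈-sym (*-identityʳ k)))

  *-homogeneousʳ : ∀ k → Homogeneous (_* k)
  *-homogeneousʳ k a = *-congˡ (≈-sym (*-identityˡ k))

  homogeneous-cancel : ∀ {σ} → Homogeneous σ → ∀ {a b} → a + b ≈ 0# → σ a + σ b ≈ 0#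
  homogeneous-cancel {σ} σ-hom {a} {b} a+b≈0 = begin
    σ a + σ b            ≈⟨ +-cong (σ-hom a) (σ-hom b) ⟩
    a * σ 1# + b * σ 1#  ≈⟨ distribʳ (σ 1#) a b ⟨
    (a + b) * σ 1#       ≈⟨ *-congʳ a+b≈0 ⟩
    0# * σ 1#            ≈⟨ zeroˡ (σ 1#) ⟩
    0#                   ∎
    where open ≈-Reasoning

  mapTerms : (Carrier → Carrier) → (Word → Word) → Poly → Poly
  mapTerms σ h = map (λ (a , u) → (σ a , h u))

  eval-mapTerms : ∀ {σ} → Homogeneous σ → ∀ g h p →
                  eval g (mapTerms σ h p) ≈ eval (λ u → σ 1# * g (h u)) p
  eval-mapTerms σ-hom g h []            = ≈-refl
  eval-mapTerms σ-hom g h ((a , u) ∷ p) =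
    +-cong (≈-trans (*-congʳ (σ-hom a)) (*-assoc _ _ _)) (eval-mapTerms σ-hom g h p)

  mapTerms-cong : ∀ {σ} → Homogeneous σ → ∀ h p q →
                  p ≋ q → mapTerms σ h p ≋ mapTerms σ h q
  mapTerms-cong {σ} σ-hom h p q p≋q w = begin
    coeff (mapTerms σ h p) w     ≈⟨ coeff-as-eval (mapTerms σ h p) w ⟩
    eval (δ w) (mapTerms σ h p)  ≈⟨ eval-mapTerms σ-hom (δ w) h p ⟩
    eval g p                     ≈⟨ eval-cong g p q p≋q ⟩
    eval g q                     ≈⟨ eval-mapTerms σ-hom (δ w) h q ⟨
    eval (δ w) (mapTerms σ h q)  ≈⟨ coeff-as-eval (mapTerms σ h q) w ⟨
    coeff (mapTerms σ h q) w     ∎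
    where
    open ≈-Reasoning
    g : Word → Carrier
    g u = σ 1# * δ w (h u)

  ⊗-∷ : ∀ p k v b → (p ⊗ ((k , v) ∷ b)) ≋ (mapTerms (_* k) (_++ v) p ++ (p ⊗ b))
  ⊗-∷ []            k v b = λ _ → ≈-refl
  ⊗-∷ ((a , u) ∷ p) k v b = ∷-cong (u ++ v) _ _ ≈-refl (begin
    G ++ (p ⊗ ((k , v) ∷ b))  ≈⟨ ++-cong G G _ _ (λ _ → ≈-refl) (⊗-∷ p k v b) ⟩
    G ++ (M ++ (p ⊗ b))       ≈⟨ ++-leftComm G M (p ⊗ b) ⟩
    M ++ (G ++ (p ⊗ b))       ∎)
    where
    open ≋-Reasoning
    G = mapTerms (a *_) (u ++_) b
    M = mapTerms (_* k) (_++ v) p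

  ⊗-zeroʳ : ∀ p → p ⊗ [] ≡ []
  ⊗-zeroʳ []      = refl
  ⊗-zeroʳ (_ ∷ p) = ⊗-zeroʳ p

  record Edge : Set (c ⊔ ℓ) where
    constructor edge
    field
      a b   : Carrier
      U V   : Word
      a+b≈0 : a + b ≈ 0#
      U⇝V   : SwapSeq U V

  ⟦_⟧ : List Edge → Poly
  ⟦ [] ⟧                      = []
  ⟦ edge a b U V _ _ ∷ E ⟧ = (a , U) ∷ (b , V) ∷ ⟦ E ⟧

  ⟦⟧-++ : ∀ E F → ⟦ E ++ F ⟧ ≡ ⟦ E ⟧ ++ ⟦ F ⟧
  ⟦⟧-++ []                       F = refl
  ⟦⟧-++ (edge a b U V _ _ ∷ E) F = ≡.cong (λ p → (a , U) ∷ (b , V) ∷ p) (⟦⟧-++ E F)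

  mapEdge : ∀ {σ h} → Homogeneous σ → h Preserves SwapSeq ⟶ SwapSeq → Edge → Edge
  mapEdge {σ} {h} σ-hom h-pres (edge a b U V a+b≈0 U⇝V) =
    edge (σ a) (σ b) (h U) (h V) (homogeneous-cancel σ-hom a+b≈0) (h-pres U⇝V)

  mapTerms-⟦⟧ : ∀ {σ h} (σ-hom : Homogeneous σ) (h-pres : h Preserves SwapSeq ⟶ SwapSeq) E →
                mapTerms σ h ⟦ E ⟧ ≡ ⟦ map (mapEdge σ-hom h-pres) E ⟧
  mapTerms-⟦⟧ σ-hom h-pres []                       = refl
  mapTerms-⟦⟧ {σ} {h} σ-hom h-pres (edge a b U V _ _ ∷ E) =
    ≡.cong (λ p → (σ a , h U) ∷ (σ b , h V) ∷ p) (mapTerms-⟦⟧ σ-hom h-pres E)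

  record EdgeSum (p : Poly) : Set (c ⊔ ℓ) where
    constructor _,_
    field
      edges  : List Edge
      ≋edges : p ≋ ⟦ edges ⟧

  EdgeSum-resp : ∀ {p q} → p ≋ q → EdgeSum p → EdgeSum q
  EdgeSum-resp p≋q (E , p≋E) = E , λ w → ≈-trans (≈-sym (p≋q w)) (p≋E w)

  EdgeSum-++ : ∀ {p q} → EdgeSum p → EdgeSum q → EdgeSum (p ++ q)
  EdgeSum-++ {p} {q} (E , p≋E) (F , q≋F) = E ++ F , (begin
    p ++ q            ≈⟨ ++-cong p ⟦ E ⟧ q ⟦ F ⟧ p≋E q≋F ⟩
    ⟦ E ⟧ ++ ⟦ F ⟧    ≡⟨ ⟦⟧-++ E F ⟨
    ⟦ E ++ F ⟧        ∎)
    where open ≋-Reasoning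

  EdgeSum-mapTerms : ∀ {σ h} → Homogeneous σ → h Preserves SwapSeq ⟶ SwapSeq →
                     ∀ {p} → EdgeSum p → EdgeSum (mapTerms σ h p)
  EdgeSum-mapTerms {σ} {h} σ-hom h-pres {p} (E , p≋E) = map (mapEdge σ-hom h-pres) E , (begin
    mapTerms σ h p                        ≈⟨ mapTerms-cong σ-hom h p ⟦ E ⟧ p≋E ⟩
    mapTerms σ h ⟦ E ⟧                    ≡⟨ mapTerms-⟦⟧ σ-hom h-pres E ⟩
    ⟦ map (mapEdge σ-hom h-pres) E ⟧      ∎)
    where open ≋-Reasoning

  EdgeSum-⊗ˡ : ∀ a {p} → EdgeSum p → EdgeSum (a ⊗ p)
  EdgeSum-⊗ˡ []            _ = [] , λ _ → ≈-refl
  EdgeSum-⊗ˡ ((k , u) ∷ a) s =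
    EdgeSum-++ (EdgeSum-mapTerms (*-homogeneousˡ k) (SwapSeq-++ˡ u) s) (EdgeSum-⊗ˡ a s)

  EdgeSum-⊗ʳ : ∀ {p} → EdgeSum p → ∀ b → EdgeSum (p ⊗ b)
  EdgeSum-⊗ʳ {p} _ []            rewrite ⊗-zeroʳ p = [] , λ _ → ≈-refl
  EdgeSum-⊗ʳ {p} s ((k , v) ∷ b) =
    EdgeSum-resp (λ w → ≈-sym (⊗-∷ p k v b w))
      (EdgeSum-++ (EdgeSum-mapTerms (*-homogeneousʳ k) (SwapSeq-++ʳ v) s) (EdgeSum-⊗ʳ s b))

  InJ⇒EdgeSum : ∀ {p} → InJ p → EdgeSum p
  InJ⇒EdgeSum (gen (comm F G nF nG)) =
    edge 1# (- 1#) (F ++ G) (G ++ F) (-‿inverseʳ 1#) (Swap-++-comm nF nG ◅ ε) ∷ [] , λ _ → ≈-refl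
  InJ⇒EdgeSum zer         = [] , λ _ → ≈-refl
  InJ⇒EdgeSum (add i j)   = EdgeSum-++ (InJ⇒EdgeSum i) (InJ⇒EdgeSum j)
  InJ⇒EdgeSum (lmul a i)  = EdgeSum-⊗ˡ a (InJ⇒EdgeSum i)
  InJ⇒EdgeSum (rmul b i)  = EdgeSum-⊗ʳ (InJ⇒EdgeSum i) b
  InJ⇒EdgeSum (resp e i)  = EdgeSum-resp e (InJ⇒EdgeSum i)

  word⊖word≋[]⇒≡ : ∀ X Y → (word X ⊖ word Y) ≋ [] → X ≡ Y
  word⊖word≋[]⇒≡ X Y X-Y≋[] with X ≟W X | X-Y≋[] X
  ... | no X≢X | _ = ⊥-elim (X≢X refl)
  ... | yes _  | 1+[-1·Y]≈0 with Y ≟W X | 1+[-1·Y]≈0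
  ...   | yes Y≡X | _     = ≡.sym Y≡X
  ...   | no _    | 1+0≈0 = ⊥-elim (1≉0 (≈-trans (≈-sym (+-identityʳ 1#)) 1+0≈0))

  EdgeSum⇒SwapSeq : ∀ X Y → EdgeSum (word X ⊖ word Y) → SwapSeq X Y
  EdgeSum⇒SwapSeq X Y (E , X-Y≋E) = go (length E) E refl X Y X-Y≋E
    where
    go : ∀ n E → length E ≡ n → ∀ X Y → (word X ⊖ word Y) ≋ ⟦ E ⟧ → SwapSeq X Y
    go _ [] _ X Y X-Y≋[] = ≡.subst (SwapSeq X) (word⊖word≋[]⇒≡ X Y X-Y≋[]) ε
    go (suc n) E@(edge a b U V a+b≈0 U⇝V ∷ E₀) refl X Y X-Y≋E =
      merge-linked U⇝V X ◅◅
      go n E′ (length-map _ E₀) (f X) (f Y) fX-fY≋E′ ◅◅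
      SwapSeq-sym (merge-linked U⇝V Y)
      where
      f : Word → Word
      f = merge U V
      f-pres : f Preserves SwapSeq ⟶ SwapSeq
      f-pres = merge-preserves U⇝V
      E′ : List Edge
      E′ = map (mapEdge id-homogeneous f-pres) E₀
      fX-fY≋E′ : (word (f X) ⊖ word (f Y)) ≋ ⟦ E′ ⟧
      fX-fY≋E′ = begin
        mapTerms id f (word X ⊖ word Y)  ≈⟨ mapTerms-cong id-homogeneous f (word X ⊖ word Y) ⟦ E ⟧ X-Y≋E ⟩
        mapTerms id f ⟦ E ⟧              ≡⟨ mapTerms-⟦⟧ id-homogeneous f-pres E ⟩
        (a , f U) ∷ (b , f V) ∷ ⟦ E′ ⟧  ≡⟨ cong₂ edgeTerms (merge-source U V) (merge-target U V) ⟩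
        (a , U) ∷ (b , U) ∷ ⟦ E′ ⟧      ≈⟨ cancel U ⟦ E′ ⟧ a+b≈0 ⟩
        ⟦ E′ ⟧                          ∎
        where
        open ≋-Reasoning
        edgeTerms : Word → Word → Poly
        edgeTerms U′ V′ = (a , U′) ∷ (b , V′) ∷ ⟦ E′ ⟧

  ∼⇒SwapSeq : ∀ {X Y} → X ∼ Y → SwapSeq X Y
  ∼⇒SwapSeq {X} {Y} X∼Y = EdgeSum⇒SwapSeq X Y (InJ⇒EdgeSum X∼Y)

  ∼-refl : ∀ {X} → X ∼ X
  ∼-refl {X} = resp (λ w → ≈-sym (cancel X [] (-‿inverseʳ 1#) w)) zer

  ∼-trans : ∀ {X Y Z} → X ∼ Y → Y ∼ Z → X ∼ Z
  ∼-trans {X} {Y} {Z} X∼Y Y∼Z =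
    resp (∷-cong X _ _ ≈-refl (cancel Y ((- 1# , Z) ∷ []) (-‿inverseˡ 1#))) (add X∼Y Y∼Z)

  ∼-cong : ∀ W₁ W₂ {X Y} → X ∼ Y → (W₁ ++ X ++ W₂) ∼ (W₁ ++ Y ++ W₂)
  ∼-cong W₁ W₂ {X} {Y} X∼Y =
    resp (∷-cong W₁XW₂ ((1# * (- 1# * 1#) , W₁YW₂) ∷ []) ((- 1# , W₁YW₂) ∷ []) 1·[1·1]≈1
                 (∷-cong W₁YW₂ [] [] 1·[-1·1]≈-1 λ _ → ≈-refl))
         (lmul (word W₁) (rmul (word W₂) X∼Y))
    where
    W₁XW₂ W₁YW₂ : Word
    W₁XW₂ = W₁ ++ X ++ W₂
    W₁YW₂ = W₁ ++ Y ++ W₂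
    1·[1·1]≈1 : 1# * (1# * 1#) ≈ 1#
    1·[1·1]≈1 = ≈-trans (*-identityˡ _) (*-identityˡ 1#)
    1·[-1·1]≈-1 : 1# * (- 1# * 1#) ≈ - 1#
    1·[-1·1]≈-1 = ≈-trans (*-identityˡ _) (*-identityʳ (- 1#))

  Swap⇒∼ : ∀ {Z Z′} → Swap Z Z′ → Z ∼ Z′
  Swap⇒∼ (W₁ , F , G , W₂ , nF , nG , inj₁ (refl , refl)) = ∼-cong W₁ W₂ (gen (comm F G nF nG))
  Swap⇒∼ (W₁ , F , G , W₂ , nF , nG , inj₂ (refl , refl)) = ∼-cong W₁ W₂ (gen (comm G F nG nF))

  SwapSeq⇒∼ : ∀ {X Y} → SwapSeq X Y → X ∼ Y
  SwapSeq⇒∼ = fold _∼_ (λ Z⇝Z′ Z′∼Y → ∼-trans (Swap⇒∼ Z⇝Z′) Z′∼Y) ∼-refl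

proposition3p2 : ∀ {c ℓ} (K : Field c ℓ) (X Y : Word) →
    (FreeAlgebra._∼_ K X Y) ⇔ SwapSeq X Y
proposition3p2 K X Y = mk⇔ (∼⇒SwapSeq K) (SwapSeq⇒∼ K)
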